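{- Let $G$ be a VC-irreducible graph. Then every graph in $\mathrm{Par}^*(G)$ is VC-irreducible.
   Context: A connected graph $G=(V,E)$ is VC-irreducible if for every edge $e\in E$ the graph $(V,E\setminus\{e\})$ has strictly smaller minimum vertex cover size than $G$. For $G=(V,E)$, $\mathrm{Par}(G)$ is the set of graphs obtained from $G$ by adding a new vertex $u\notin V$ and the edges $\{\{u,v'\}: v'\in N_G(v)\cup\{v\}\}$ for some $v\in V$ ($N_G(v)$ the neighborhood of $v$). For a family $\mathcal{G}$, $\mathrm{Par}(\mathcal{G})=\bigcup_{H\in\mathcal{G}}\mathrm{Par}(H)$; $\mathrm{Par}^0(G)=\{G\}$, $\mathrm{Par}^k(G)=\mathrm{Par}(\mathrm{Par}^{k-1}(G))$ and $\mathrm{Par}^*(G)=\bigcup_{k\ge 0}\mathrm{Par}^k(G)$. -}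

module Defs where

open import Data.Nat using (ℕ; zero; suc; _<_; _≤_)
open import Data.Fin using (Fin; zero; suc; _≟_)
open import Data.Fin.Subset using (Subset; _∈_; ∣_∣)
open import Data.Bool using (Bool; true; false; _∧_; _∨_; not)
open import Data.Sum using (_⊎_)
open import Data.Product using (_×_; Σ)
open import Relation.Nullary.Decidable using (⌊_⌋)
open import Relation.Binary.PropositionalEquality using (_≡_)

Graph : ℕ → Set
Graph n = Fin n → Fin n → Bool

IsSimple : ∀ {n} → Graph n → Set
IsSimple {n} G = (∀ (x y : Fin n) → G x y ≡ G y x) × (∀ (x : Fin n) → G x x ≡ false)

data Reach {n} (G : Graph n) : Fin n → Fin n → Set where
  reach-refl : ∀ {x} → Reach G x x
  reach-step : ∀ {x y z} → G x y ≡ true → Reach G y z → Reach G x z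

Connected : ∀ {n} → Graph n → Set
Connected {n} G = ∀ (x y : Fin n) → Reach G x y

IsVertexCover : ∀ {n} → Graph n → Subset n → Set
IsVertexCover {n} G C = ∀ (x y : Fin n) → G x y ≡ true → (x ∈ C) ⊎ (y ∈ C)

MinVC : ∀ {n} → Graph n → ℕ → Set
MinVC {n} G k =
  Σ (Subset n) (λ C → IsVertexCover G C × ∣ C ∣ ≡ k)
  × (∀ (C : Subset n) → IsVertexCover G C → k ≤ ∣ C ∣)

removeEdge : ∀ {n} → Graph n → Fin n → Fin n → Graph n
removeEdge G a b x y =
  G x y ∧ not ((⌊ x ≟ a ⌋ ∧ ⌊ y ≟ b ⌋) ∨ (⌊ x ≟ b ⌋ ∧ ⌊ y ≟ a ⌋))

VCIrreducible : ∀ {n} → Graph n → Set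
VCIrreducible {n} G =
  Connected G ×
  (∀ (a b : Fin n) → G a b ≡ true →
     ∀ (k k' : ℕ) → MinVC G k → MinVC (removeEdge G a b) k' → k' < k)

-- One Par step: new vertex (index zero, old vertices shifted by suc)
-- adjacent to N_G(v) ∪ {v}.
par : ∀ {n} → Graph n → Fin n → Graph (suc n)
par G v zero    zero    = false
par G v zero    (suc w) = G v w ∨ ⌊ v ≟ w ⌋
par G v (suc w) zero    = G v w ∨ ⌊ v ≟ w ⌋
par G v (suc x) (suc y) = G x y

data ParStar {n} (G : Graph n) : ∀ {m} → Graph m → Set where
  par-zero : ParStar G G
  par-step : ∀ {m} {H : Graph m} → ParStar G H → (v : Fin m) → ParStar G (par H v)

-- Let H = par G v with new vertex u and τ = τ(G). A cover of H either contains u, and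
-- then restricts to a cover of G, or contains N[v], and then loses v and still covers G;
-- so every cover of H has more than τ vertices. Conversely, for every edge e of H the
-- graph H − e has a cover of size at most τ: for an old edge xy add u to a cover of G − xy,
-- which has fewer than τ vertices by irreducibility of G; for a new edge uw pick an edge
-- vx of G with w ∈ {v, x}, take a cover D of G − vx of size < τ, which misses v and x
-- and hence contains N(v) ∖ {x}, and add the endpoint of vx other than w. Hence
-- τ(H − e) ≤ τ < τ(H), and induction along Par* finishes the proof.
module Submission where

open import Data.Nat using (ℕ; zero; suc; _<_; _≤_; _<?_; s≤s)
open import Data.Nat.Properties
  using (≤-refl; ≤-trans; n≤1+n; <⇒≱; ≮⇒≥; module ≤-Reasoning)
open import Data.Fin using (Fin; zero; suc; _≟_)
open import Data.Fin.Properties using (any?; all?)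
open import Data.Fin.Subset
  using (Subset; _∈_; _∉_; _⊆_; ∣_∣; _∪_; ⁅_⁆; _-_; ⊤; inside; outside)
open import Data.Fin.Subset.Properties
  using ( _∈?_; anySubset?; ∈⊤; drop-there; x∈⁅x⁆; p⊆p∪q; q⊆p∪q
        ; ∪-identityʳ; x∈p∧x≢y⇒x∈p-y; x∈p⇒∣p-x∣<∣p∣ )
open import Data.Bool using (true; false; _∧_; not)
import Data.Bool as Bool
open import Data.Bool.Properties using (∨-comm)
open import Data.Vec.Base using (_∷_; here; there)
open import Data.Sum using (_⊎_; inj₁; inj₂; fromInj₂)
import Data.Sum as Sum
import Data.Product as Product
open import Data.Product using (_×_; Σ; _,_; proj₁; proj₂)
open import Data.Empty using (⊥)
open import Induction.WellFounded using (Acc; acc)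
open import Data.Nat.Induction using (<-wellFounded)
open import Relation.Nullary using (¬_; Dec; yes; no; contradiction)
open import Relation.Nullary.Decidable
  using (⌊_⌋; isYes≗does; _×-dec_; _⊎-dec_; _→-dec_)
open import Relation.Binary.PropositionalEquality
  using (_≡_; _≢_; refl; sym; trans; cong)
open import Defs

private
  variable
    n : ℕ

SameEdge : (a b x y : Fin n) → Set
SameEdge a b x y = (x ≡ a × y ≡ b) ⊎ (x ≡ b × y ≡ a)

sameEdge? : (a b x y : Fin n) → Dec (SameEdge a b x y)
sameEdge? a b x y = (x ≟ a ×-dec y ≟ b) ⊎-dec (x ≟ b ×-dec y ≟ a)

SameEdge-suc : ∀ {a b x y : Fin n} → SameEdge a b x y → SameEdge (suc a) (suc b) (suc x) (suc y)
SameEdge-suc = Sum.map (Product.map (cong suc) (cong suc)) (Product.map (cong suc) (cong suc))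

SameEdge⇒endpoint : ∀ {a b x y : Fin n} → SameEdge a b x y → a ≡ y ⊎ b ≡ y
SameEdge⇒endpoint (inj₁ (_ , refl)) = inj₂ refl
SameEdge⇒endpoint (inj₂ (_ , refl)) = inj₁ refl

SameEdge⇒other-endpoint : ∀ {a b x y q : Fin n} → SameEdge a b x y →
                          q ≡ a ⊎ q ≡ b → q ≢ x → q ≡ y
SameEdge⇒other-endpoint (inj₁ (refl , refl)) (inj₁ refl) q≢x = contradiction refl q≢x
SameEdge⇒other-endpoint (inj₁ (refl , refl)) (inj₂ refl) _   = refl
SameEdge⇒other-endpoint (inj₂ (refl , refl)) (inj₁ refl) _   = refl
SameEdge⇒other-endpoint (inj₂ (refl , refl)) (inj₂ refl) q≢x = contradiction refl q≢x

removeEdge≡ : ∀ (G : Graph n) a b x y →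
              removeEdge G a b x y ≡ G x y ∧ not ⌊ sameEdge? a b x y ⌋
removeEdge≡ G a b x y
  rewrite isYes≗does (x ≟ a) | isYes≗does (y ≟ b) | isYes≗does (x ≟ b)
        | isYes≗does (y ≟ a) | isYes≗does (sameEdge? a b x y) = refl

removeEdge⇒ : ∀ (G : Graph n) a b x y → removeEdge G a b x y ≡ true →
              G x y ≡ true × ¬ SameEdge a b x y
removeEdge⇒ G a b x y rewrite removeEdge≡ G a b x y = ∧-not⇒ (G x y) (sameEdge? a b x y)
  where
  ∧-not⇒ : ∀ {P : Set} g (P? : Dec P) → g ∧ not ⌊ P? ⌋ ≡ true → g ≡ true × ¬ P
  ∧-not⇒ true (no ¬p) refl = refl , ¬p

removeEdge⁺ : ∀ (G : Graph n) a b x y → G x y ≡ true → ¬ SameEdge a b x y →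
              removeEdge G a b x y ≡ true
removeEdge⁺ G a b x y rewrite removeEdge≡ G a b x y = ∧-not⁺ (G x y) (sameEdge? a b x y)
  where
  ∧-not⁺ : ∀ {P : Set} g (P? : Dec P) → g ≡ true → ¬ P → g ∧ not ⌊ P? ⌋ ≡ true
  ∧-not⁺ g (yes p) _    ¬p = contradiction p ¬p
  ∧-not⁺ g (no _)  refl _  = refl

removeEdge-comm : ∀ (G : Graph n) a b x y → removeEdge G a b x y ≡ removeEdge G b a x y
removeEdge-comm G a b x y =
  cong (λ t → G x y ∧ not t) (∨-comm (⌊ x ≟ a ⌋ ∧ ⌊ y ≟ b ⌋) (⌊ x ≟ b ⌋ ∧ ⌊ y ≟ a ⌋))

isVertexCover? : (G : Graph n) (C : Subset n) → Dec (IsVertexCover G C)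
isVertexCover? G C =
  all? λ x → all? λ y → (G x y Bool.≟ true) →-dec ((x ∈? C) ⊎-dec (y ∈? C))

IsVertexCover-mono : ∀ {G : Graph n} {C D} → C ⊆ D → IsVertexCover G C → IsVertexCover G D
IsVertexCover-mono C⊆D cov x y e = Sum.map C⊆D C⊆D (cov x y e)

minVC-exists : (G : Graph n) → Σ ℕ (MinVC G)
minVC-exists {n} G = descend ⊤ (λ _ _ _ → inj₁ ∈⊤) (<-wellFounded ∣ ⊤ {n} ∣)
  where
  descend : ∀ C → IsVertexCover G C → Acc _<_ ∣ C ∣ → Σ ℕ (MinVC G)
  descend C cov (acc smaller)
    with anySubset? (λ D → isVertexCover? G D ×-dec (∣ D ∣ <? ∣ C ∣))
  ... | yes (D , covD , D<C) = descend D covD (smaller D<C)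
  ... | no ∄D = ∣ C ∣ , (C , cov , refl) , λ D covD → ≮⇒≥ λ D<C → ∄D (D , covD , D<C)

removeEdge-cover⇒cover : ∀ {G : Graph n} {a b C} →
  IsVertexCover (removeEdge G a b) C → a ∈ C ⊎ b ∈ C → IsVertexCover G C
removeEdge-cover⇒cover {G = G} {a} {b} cov a∈C⊎b∈C x y e with sameEdge? a b x y
... | yes (inj₁ (refl , refl)) = a∈C⊎b∈C
... | yes (inj₂ (refl , refl)) = Sum.swap a∈C⊎b∈C
... | no ¬same = cov x y (removeEdge⁺ G a b x y e ¬same)

removeEdge-cover-neighbour : ∀ {G : Graph n} {a b C q} →
  IsVertexCover (removeEdge G a b) C → a ∉ C → G a q ≡ true → q ≢ b → q ∈ C
removeEdge-cover-neighbour {G = G} {a} {b} {q = q} cov a∉C e q≢b =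
  fromInj₂ (λ a∈C → contradiction a∈C a∉C) (cov a q (removeEdge⁺ G a b a q e not-ab))
  where
  not-ab : ¬ SameEdge a b a q
  not-ab (inj₁ (_ , q≡b))   = q≢b q≡b
  not-ab (inj₂ (a≡b , q≡a)) = q≢b (trans q≡a a≡b)

module _ {G : Graph n} {τ} (minG : MinVC G τ) where

  removeEdge-smallCover-avoids : ∀ {a b C} → IsVertexCover (removeEdge G a b) C →
                                 ∣ C ∣ < τ → a ∉ C × b ∉ C
  removeEdge-smallCover-avoids {C = C} cov C<τ =
    (λ a∈C → ¬cover (removeEdge-cover⇒cover cov (inj₁ a∈C))) ,
    (λ b∈C → ¬cover (removeEdge-cover⇒cover cov (inj₂ b∈C)))
    where
    ¬cover : ¬ IsVertexCover G C
    ¬cover covG = <⇒≱ C<τ (proj₂ minG C covG)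

  removeEdge-smallCover : VCIrreducible G → ∀ {a b} → G a b ≡ true →
    Σ (Subset n) λ D → IsVertexCover (removeEdge G a b) D × ∣ D ∣ < τ
  removeEdge-smallCover irr {a} {b} e with minVC-exists (removeEdge G a b)
  ... | k , minR@((D , covD , refl) , _) = D , covD , proj₂ irr a b e τ k minG minR

∣p∪⁅x⁆∣≤1+∣p∣ : ∀ (p : Subset n) x → ∣ p ∪ ⁅ x ⁆ ∣ ≤ suc ∣ p ∣
∣p∪⁅x⁆∣≤1+∣p∣ (outside ∷ p) zero    rewrite ∪-identityʳ p = ≤-refl
∣p∪⁅x⁆∣≤1+∣p∣ (inside  ∷ p) zero    rewrite ∪-identityʳ p = n≤1+n _
∣p∪⁅x⁆∣≤1+∣p∣ (outside ∷ p) (suc x) = ∣p∪⁅x⁆∣≤1+∣p∣ p x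
∣p∪⁅x⁆∣≤1+∣p∣ (inside  ∷ p) (suc x) = s≤s (∣p∪⁅x⁆∣≤1+∣p∣ p x)

module _ (G : Graph n) (v : Fin n) where

  private
    H : Graph (suc n)
    H = par G v

  par-new-edge⇒ : ∀ {q} → H zero (suc q) ≡ true → G v q ≡ true ⊎ v ≡ q
  par-new-edge⇒ {q} e with G v q | v ≟ q
  ... | true  | _        = inj₁ refl
  ... | false | yes v≡q = inj₂ v≡q

  par-new-edge⁺ : ∀ {q} → G v q ≡ true ⊎ v ≡ q → H zero (suc q) ≡ true
  par-new-edge⁺ {q} (inj₁ e) rewrite e = refl
  par-new-edge⁺ {q} (inj₂ refl) with G v v | v ≟ v
  ... | true  | _      = refl
  ... | false | yes _  = refl
  ... | false | no v≢v = contradiction refl v≢v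

  par-Reach : ∀ {x y} → Reach G x y → Reach H (suc x) (suc y)
  par-Reach reach-refl       = reach-refl
  par-Reach (reach-step e r) = reach-step e (par-Reach r)

  par-connected : Connected G → Connected H
  par-connected conn zero    zero    = reach-refl
  par-connected conn zero    (suc y) = reach-step (par-new-edge⁺ (inj₂ refl)) (par-Reach (conn v y))
  par-connected conn (suc x) zero    = Reach-trans (par-Reach (conn x v))
                                         (reach-step (par-new-edge⁺ (inj₂ refl)) reach-refl)
    where
    Reach-trans : ∀ {x y z} → Reach H x y → Reach H y z → Reach H x z
    Reach-trans reach-refl       r′ = r′
    Reach-trans (reach-step e r) r′ = reach-step e (Reach-trans r r′)
  par-connected conn (suc x) (suc y) = par-Reach (conn x y)

  par-simple : IsSimple G → IsSimple H
  par-simple (sym-G , irrefl-G) = sym-H , irrefl-H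
    where
    sym-H : ∀ x y → H x y ≡ H y x
    sym-H zero    zero    = refl
    sym-H zero    (suc y) = refl
    sym-H (suc x) zero    = refl
    sym-H (suc x) (suc y) = sym-G x y
    irrefl-H : ∀ x → H x x ≡ false
    irrefl-H zero    = refl
    irrefl-H (suc x) = irrefl-G x

  par-cover⇒cover : ∀ {s D} → IsVertexCover H (s ∷ D) → IsVertexCover G D
  par-cover⇒cover cov x y e = Sum.map drop-there drop-there (cov (suc x) (suc y) e)

  par-cover⇒smaller-cover : IsSimple G → ∀ {C} → IsVertexCover H C →
    Σ (Subset n) λ D → IsVertexCover G D × ∣ D ∣ < ∣ C ∣
  par-cover⇒smaller-cover _ {inside ∷ D} cov = D , par-cover⇒cover cov , ≤-refl
  par-cover⇒smaller-cover (sym-G , irrefl-G) {outside ∷ D} cov =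
    D - v , cover-without-v , x∈p⇒∣p-x∣<∣p∣ (closedNbr⊆D (inj₂ refl))
    where
    closedNbr⊆D : ∀ {q} → G v q ≡ true ⊎ v ≡ q → q ∈ D
    closedNbr⊆D nq with cov zero (suc _) (par-new-edge⁺ nq)
    ... | inj₂ (there q∈D) = q∈D
    nbr⊆D-v : ∀ {q} → G v q ≡ true → q ∈ D - v
    nbr⊆D-v e = x∈p∧x≢y⇒x∈p-y (closedNbr⊆D (inj₁ e)) λ { refl → no-loop e }
      where
      no-loop : G v v ≡ true → ⊥
      no-loop e with () ← trans (sym e) (irrefl-G v)
    cover-without-v : IsVertexCover G (D - v)
    cover-without-v x y e with x ≟ v | y ≟ v
    ... | yes refl | _        = inj₂ (nbr⊆D-v e)
    ... | no _     | yes refl = inj₁ (nbr⊆D-v (trans (sym-G v x) e))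
    ... | no x≢v   | no y≢v   = Sum.map (λ x∈D → x∈p∧x≢y⇒x∈p-y x∈D x≢v)
                                        (λ y∈D → x∈p∧x≢y⇒x∈p-y y∈D y≢v)
                                        (par-cover⇒cover cov x y e)

  par-cover-removeOld : ∀ {x y D} → IsVertexCover (removeEdge G x y) D →
                        IsVertexCover (removeEdge H (suc x) (suc y)) (inside ∷ D)
  par-cover-removeOld cov zero    _       _ = inj₁ here
  par-cover-removeOld cov (suc p) zero    _ = inj₂ here
  par-cover-removeOld {x} {y} cov (suc p) (suc q) e
    with removeEdge⇒ H (suc x) (suc y) (suc p) (suc q) e
  ... | e′ , ¬same = Sum.map there there
                       (cov p q (removeEdge⁺ G x y p q e′ λ same → ¬same (SameEdge-suc same)))

  par-cover-removeNew : ∀ {w D} → IsVertexCover G D →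
                        (∀ {q} → G v q ≡ true ⊎ v ≡ q → q ≢ w → q ∈ D) →
                        IsVertexCover (removeEdge H zero (suc w)) (outside ∷ D)
  par-cover-removeNew {w} covG nbr zero zero e
    with () ← proj₁ (removeEdge⇒ H zero (suc w) zero zero e)
  par-cover-removeNew {w} covG nbr zero (suc q) e
    with removeEdge⇒ H zero (suc w) zero (suc q) e
  ... | e′ , ¬same = inj₂ (there (nbr (par-new-edge⇒ e′) λ { refl → ¬same (inj₁ (refl , refl)) }))
  par-cover-removeNew {w} covG nbr (suc p) zero e
    with removeEdge⇒ H zero (suc w) (suc p) zero e
  ... | e′ , ¬same = inj₁ (there (nbr (par-new-edge⇒ e′) λ { refl → ¬same (inj₂ (refl , refl)) }))
  par-cover-removeNew {w} covG nbr (suc p) (suc q) e =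
    Sum.map there there (covG p q (proj₁ (removeEdge⇒ H zero (suc w) (suc p) (suc q) e)))

  module _ (irr : VCIrreducible G) {τ} (minG : MinVC G τ) where

    CoverWithin : ∀ {m} → Graph m → Set
    CoverWithin {m} K = Σ (Subset m) λ D → IsVertexCover K D × ∣ D ∣ ≤ τ

    par-removeNewEdge-cover : ∀ {x w y} → G v x ≡ true → SameEdge v x w y →
                              CoverWithin (removeEdge H zero (suc w))
    par-removeNewEdge-cover {x} {w} {y} e wy≐vx with removeEdge-smallCover minG irr e
    ... | D , cov , D<τ =
      outside ∷ (D ∪ ⁅ y ⁆) , par-cover-removeNew covG nbr , ≤-trans (∣p∪⁅x⁆∣≤1+∣p∣ D y) D<τ
      where
      v∉D : v ∉ D
      v∉D = proj₁ (removeEdge-smallCover-avoids minG cov D<τ)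
      ∈⁅y⁆ : ∀ {q} → q ≡ y → q ∈ D ∪ ⁅ y ⁆
      ∈⁅y⁆ refl = q⊆p∪q D ⁅ y ⁆ (x∈⁅x⁆ y)
      covG : IsVertexCover G (D ∪ ⁅ y ⁆)
      covG = removeEdge-cover⇒cover (IsVertexCover-mono (p⊆p∪q ⁅ y ⁆) cov)
                                    (Sum.map ∈⁅y⁆ ∈⁅y⁆ (SameEdge⇒endpoint wy≐vx))
      nbr : ∀ {q} → G v q ≡ true ⊎ v ≡ q → q ≢ w → q ∈ D ∪ ⁅ y ⁆
      nbr (inj₂ refl) q≢w = ∈⁅y⁆ (SameEdge⇒other-endpoint wy≐vx (inj₁ refl) q≢w)
      nbr {q} (inj₁ e′) q≢w with q ≟ x
      ... | yes refl = ∈⁅y⁆ (SameEdge⇒other-endpoint wy≐vx (inj₂ refl) q≢w)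
      ... | no q≢x   = p⊆p∪q ⁅ y ⁆ (removeEdge-cover-neighbour cov v∉D e′ q≢x)

    par-removeEdge-cover : ∀ {a b} → H a b ≡ true → CoverWithin (removeEdge H a b)
    par-removeEdge-cover {zero}  {suc w} e = new-edge (par-new-edge⇒ e)
      where
      new-edge : ∀ {w} → G v w ≡ true ⊎ v ≡ w → CoverWithin (removeEdge H zero (suc w))
      new-edge (inj₁ e) = par-removeNewEdge-cover e (inj₂ (refl , refl))
      -- The edge uv: use an edge vx of G, or, if v is isolated, a minimum cover of G.
      new-edge (inj₂ refl) with any? (λ x → G v x Bool.≟ true)
      ... | yes (x , e) = par-removeNewEdge-cover e (inj₁ (refl , refl))
      ... | no isolated with proj₁ minG
      ...   | C , cov , refl = outside ∷ C , par-cover-removeNew cov nbr , ≤-refl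
        where
        nbr : ∀ {q} → G v q ≡ true ⊎ v ≡ q → q ≢ v → q ∈ C
        nbr (inj₁ e)    _   = contradiction (_ , e) isolated
        nbr (inj₂ refl) q≢v = contradiction refl q≢v
    par-removeEdge-cover {suc w} {zero} e with par-removeEdge-cover {zero} {suc w} e
    ... | D , cov , D≤τ =
      D , (λ x y e′ → cov x y (trans (removeEdge-comm H zero (suc w) x y) e′)) , D≤τ
    par-removeEdge-cover {suc x} {suc y} e with removeEdge-smallCover minG irr e
    ... | D , cov , D<τ = inside ∷ D , par-cover-removeOld cov , D<τ

  par-VCIrreducible : IsSimple G → VCIrreducible G → VCIrreducible H
  par-VCIrreducible simple irr = par-connected (proj₁ irr) , τ-drops
    where
    τ-drops : ∀ a b → H a b ≡ true → ∀ k k′ → MinVC H k → MinVC (removeEdge H a b) k′ → k′ < k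
    τ-drops a b e k k′ ((C , covC , refl) , _) (_ , minimal′)
      with τ , minG ← minVC-exists G
      with D′ , covD′ , D′≤τ ← par-removeEdge-cover irr minG e
      with D , covD , D<C ← par-cover⇒smaller-cover simple covC = begin-strict
        k′    ≤⟨ minimal′ D′ covD′ ⟩
        ∣ D′ ∣ ≤⟨ D′≤τ ⟩
        τ     ≤⟨ proj₂ minG D covD ⟩
        ∣ D ∣ <⟨ D<C ⟩
        ∣ C ∣ ∎
      where open ≤-Reasoning

ParStar-simple×VCIrreducible : ∀ {G : Graph n} → IsSimple G → VCIrreducible G →
  ∀ {m} {H : Graph m} → ParStar G H → IsSimple H × VCIrreducible H
ParStar-simple×VCIrreducible simple irr par-zero = simple , irr
ParStar-simple×VCIrreducible simple irr (par-step {H = K} p v)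
  with simpleK , irrK ← ParStar-simple×VCIrreducible simple irr p =
  par-simple K v simpleK , par-VCIrreducible K v simpleK irrK

corollary3 : ∀ {n : ℕ} (G : Graph n) → IsSimple G → VCIrreducible G →
    ∀ {m : ℕ} (H : Graph m) → ParStar G H → VCIrreducible H
corollary3 G simple irr H p = proj₂ (ParStar-simple×VCIrreducible simple irr p)
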